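{- Let $\Pi$ be a finite projective plane of order $n$ and $\Gamma_{\Pi}$ its Levi graph. If $k$ is an integer with $n \geq k \geq 4$, then $$c_{2k}(\Gamma_{\Pi}) \leq \frac{1}{2k}N_{(k)} - (n-k+2)(k-1)\,c_{2k-2}(\Gamma_{\Pi}).$$
   Context: $N = n^2+n+1$; for a positive integer $x$, $x_{(m)} = x(x-1)\cdots(x-m+1)$. The Levi graph $\Gamma_{\Pi}$ is the bipartite graph whose vertex classes are the points and the lines of $\Pi$, a point adjacent to a line iff it lies on it. $c_{m}(\Gamma_{\Pi})$ is the number of cycles of length $m$ in $\Gamma_{\Pi}$. -}

module Defs where

open import Data.Nat using (ℕ; zero; suc; _+_; _*_; _∸_; _^_; _≤_)
open import Data.Nat.DivMod using (_/_)
open import Data.Fin using (Fin; splitAt)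
open import Data.Fin.Properties using () renaming (_≟_ to _≟ᶠ_)
open import Data.Bool using (Bool; true; false; _∧_; not)
open import Data.List using (List; []; _∷_; _++_; [_]; length; map; concatMap; allFin; filterᵇ)
open import Data.Bool.ListAction using (any)
open import Data.Product using (Σ; _×_; _,_)
open import Data.Sum using (inj₁; inj₂)
open import Relation.Nullary using (Dec; does; ¬_)
open import Relation.Binary.PropositionalEquality using (_≡_; _≢_)

N : ℕ → ℕ
N n = n ^ 2 + n + 1

_₍_₎ : ℕ → ℕ → ℕ
x ₍ zero ₎  = 1
x ₍ suc m ₎ = x * ((x ∸ 1) ₍ m ₎)

record ProjectivePlane (n : ℕ) : Set₁ where
  field
    nP nL : ℕ
    _I_   : Fin nP → Fin nL → Set
    I?    : ∀ x L → Dec (x I L)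

  Collinear : Fin nP → Fin nP → Fin nP → Set
  Collinear x y z = Σ (Fin nL) λ L → x I L × y I L × z I L

  pointsOn : Fin nL → List (Fin nP)
  pointsOn L = filterᵇ (λ x → does (I? x L)) (allFin nP)

  field
    joinLine : ∀ x y → x ≢ y →
      Σ (Fin nL) λ L → (x I L × y I L) × (∀ L′ → x I L′ → y I L′ → L′ ≡ L)
    meetPoint : ∀ L M → L ≢ M →
      Σ (Fin nP) λ x → (x I L × x I M) × (∀ x′ → x′ I L → x′ I M → x′ ≡ x)
    quadrangle : Σ (Fin nP) λ a → Σ (Fin nP) λ b → Σ (Fin nP) λ c → Σ (Fin nP) λ d →
      ¬ Collinear a b c × ¬ Collinear a b d × ¬ Collinear a c d × ¬ Collinear b c d
    order : ∀ L → length (pointsOn L) ≡ suc n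

record Graph : Set where
  field
    V   : ℕ
    adj : Fin V → Fin V → Bool

Levi : ∀ {n} → ProjectivePlane n → Graph
Levi Π = record { V = nP + nL ; adj = a }
  where
  open ProjectivePlane Π
  a : Fin (nP + nL) → Fin (nP + nL) → Bool
  a u v with splitAt nP u | splitAt nP v
  ... | inj₁ x | inj₂ L = does (I? x L)
  ... | inj₂ L | inj₁ x = does (I? x L)
  ... | _      | _      = false

module _ (G : Graph) where
  open Graph G

  allSeqs : ℕ → List (List (Fin V))
  allSeqs zero    = [ [] ]
  allSeqs (suc m) = concatMap (λ x → map (x ∷_) (allSeqs m)) (allFin V)

  distinct : List (Fin V) → Bool
  distinct []       = true
  distinct (x ∷ xs) = not (any (λ y → does (x ≟ᶠ y)) xs) ∧ distinct xs

  chain : List (Fin V) → Bool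
  chain (a ∷ b ∷ rest) = adj a b ∧ chain (b ∷ rest)
  chain _              = true

  cyclicChain : List (Fin V) → Bool
  cyclicChain []       = true
  cyclicChain (x ∷ xs) = chain (x ∷ xs ++ [ x ])

  isCycleSeq : List (Fin V) → Bool
  isCycleSeq vs = distinct vs ∧ cyclicChain vs

  cycleSeqCount : ℕ → ℕ
  cycleSeqCount m = length (filterᵇ isCycleSeq (allSeqs m))

  -- c_m(G): number of cycles of length m (m ≥ 3). Each cycle of length m
  -- corresponds to exactly 2m such sequences (m starting points, 2 directions).
  cycles : ℕ → ℕ
  cycles (suc (suc (suc m))) = cycleSeqCount (3 + m) / (2 * (3 + m))
  cycles _                   = 0

module Submission where

-- Rotate a 2k-cycle of the Levi graph so that it starts at a point and read off its points: this
-- is a k-gon, k distinct points no three cyclically consecutive of which are collinear, and it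
-- determines the cycle sequence, since each line of the cycle joins two consecutive points. Each
-- 2k-cycle has 2k such sequences, so 2k c_{2k} is at most the number of k-gons. Likewise, for a
-- (k-1)-gon q₁ q₂ … and one of the at least n - k + 2 points x of the line q₁q₂ outside it, the
-- sequence q₁ x q₂ … has exactly one collinear consecutive triple, at its start. Hence its k
-- rotations are no k-gons, and the rotation, the (k-1)-gon and x can be recovered from them;
-- this gives at least k (n - k + 2) 2(k-1) c_{2k-2} further sequences. All of these are distinct
-- arrangements of k of the at most N points of the plane, so there are at most N_(k) of them.

open import Defs
open import Data.Nat using (ℕ; zero; suc; _+_; _*_; _∸_; _≤_; _<_; z≤n; s≤s; _<?_)
open import Data.Nat.Properties
open import Data.Nat.DivMod using (m/n*n≤m)
open import Data.Nat.Tactic.RingSolver using (solve-∀)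
open import Data.Bool using (true; false; T; not; _∧_)
open import Data.Bool.Properties using (T-∧)
open import Data.Fin using (Fin; splitAt; _↑ˡ_; _↑ʳ_)
open import Data.Fin.Properties
  using (splitAt-↑ˡ; splitAt-↑ʳ; splitAt⁻¹-↑ˡ; splitAt⁻¹-↑ʳ) renaming (_≟_ to _≟ᶠ_)
open import Data.List
  using ( List; []; _∷_; _++_; [_]; _∷ʳ_; initLast; _∷ʳ′_; length; map; mapMaybe; concatMap
        ; filter; filterᵇ; take; upTo; allFin)
open import Data.List.Properties
  using ( length-++; length-map; ++-assoc; ++-identityʳ; ∷-injective; ∷ʳ-injective; map-++
        ; filter-notAll; length-tabulate; length-upTo)
open import Data.List.Membership.Propositional using (_∈_; _∉_; find; lose)
open import Data.List.Membership.Propositional.Properties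
open import Data.List.Relation.Binary.Subset.Propositional using (_⊆_)
open import Data.List.Relation.Unary.Any using (here; there)
open import Data.List.Relation.Unary.Any.Properties using (any⁺; any⁻)
open import Data.List.Relation.Unary.All as All using (All; []; _∷_)
open import Data.List.Relation.Unary.AllPairs as AllPairs using ([]; _∷_)
open import Data.List.Relation.Unary.Linked as Linked using (Linked; _∷_)
open import Data.List.Relation.Unary.Linked.Properties using (AllPairs⇒Linked)
open import Data.List.Relation.Unary.Unique.Propositional using (Unique)
import Data.List.Relation.Unary.Unique.Propositional.Properties as Unique
open import Data.Product using (∃; ∃₂; _×_; _,_; proj₁; proj₂)
open import Data.Product.Properties using (,-injective)
open import Data.Sum using (inj₁; inj₂; [_,_]′)
open import Data.Maybe using (Maybe; just; nothing)
open import Data.Empty using (⊥; ⊥-elim)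
open import Data.Unit using (⊤)
open import Relation.Nullary using (¬_; Dec; yes; no; does; ¬?)
open import Relation.Nullary.Decidable using (T?; decidable-stable)
open import Relation.Unary using (Pred; Decidable)
open import Relation.Unary.Properties using (∁?)
open import Relation.Binary.Definitions using (DecidableEquality; tri<; tri≈; tri>)
open import Relation.Binary.PropositionalEquality hiding ([_])
open import Function using (_∘_; id; const; Equivalence)
open import Level using (0ℓ)

module _ {A : Set} where

  Unique⇒length-≤ : ∀ {xs ys : List A} → Unique xs → xs ⊆ ys → length xs ≤ length ys
  Unique⇒length-≤ {[]} _ _ = z≤n
  Unique⇒length-≤ {x ∷ xs} (x∉xs ∷ u) xs⊆ys with as , bs , refl ← ∈-∃++ (xs⊆ys (here refl)) = begin
    suc (length xs)          ≤⟨ s≤s (Unique⇒length-≤ u xs⊆as++bs) ⟩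
    suc (length (as ++ bs))  ≡⟨ cong suc (length-++ as) ⟩
    suc (length as + length bs) ≡⟨ +-suc (length as) (length bs) ⟨
    length as + length (x ∷ bs) ≡⟨ length-++ as ⟨
    length (as ++ x ∷ bs)    ∎
    where
    open ≤-Reasoning
    xs⊆as++bs : xs ⊆ as ++ bs
    xs⊆as++bs {y} y∈xs with ∈-++⁻ as (xs⊆ys (there y∈xs))
    ... | inj₁ y∈as         = ∈-++⁺ˡ y∈as
    ... | inj₂ (here y≡x)   = ⊥-elim (All.lookup x∉xs y∈xs (sym y≡x))
    ... | inj₂ (there y∈bs) = ∈-++⁺ʳ as y∈bs

  Unique-∷ʳ : ∀ {xs : List A} {x} → Unique xs → x ∉ xs → Unique (xs ∷ʳ x)
  Unique-∷ʳ u x∉xs = Unique.++⁺ u ([] ∷ []) λ { (x∈xs , here refl) → x∉xs x∈xs }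

  Unique⇒cyclically-Linked : ∀ {x y ys} → Unique (x ∷ y ∷ ys) → Linked _≢_ (x ∷ y ∷ ys ∷ʳ x)
  Unique⇒cyclically-Linked (x∉ ∷ u) =
    All.head x∉ ∷ AllPairs⇒Linked (Unique-∷ʳ u λ x∈ → All.lookup x∉ x∈ refl)

  insertSecond : A → List A → List A
  insertSecond x []       = [ x ]
  insertSecond x (q ∷ qs) = q ∷ x ∷ qs

  length-insertSecond : ∀ x qs → length (insertSecond x qs) ≡ suc (length qs)
  length-insertSecond x []      = refl
  length-insertSecond x (_ ∷ _) = refl

  insertSecond⁺ : ∀ {x qs} → Unique qs → x ∉ qs → Unique (insertSecond x qs)
  insertSecond⁺ {qs = []}     _          _  = [] ∷ []
  insertSecond⁺ {qs = q ∷ qs} (q∉qs ∷ u) x∉ =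
    ((λ q≡x → x∉ (here (sym q≡x))) ∷ q∉qs)
      ∷ All.tabulate (λ y∈qs x≡y → x∉ (there (subst (_∈ qs) (sym x≡y) y∈qs))) ∷ u

  insertSecond-injective : ∀ {x x′ qs qs′} → insertSecond x qs ≡ insertSecond x′ qs′ →
    x ≡ x′ × qs ≡ qs′
  insertSecond-injective {qs = []}    {[]}    refl = refl , refl
  insertSecond-injective {qs = _ ∷ _} {_ ∷ _} refl = refl , refl

  module _ {p} {P : Pred A p} (P? : Decidable P) where

    length-filter+length-filter-∁ : ∀ xs →
      length (filter P? xs) + length (filter (∁? P?) xs) ≡ length xs
    length-filter+length-filter-∁ [] = refl
    length-filter+length-filter-∁ (x ∷ xs) with P? x
    ... | yes _ = cong suc (length-filter+length-filter-∁ xs)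
    ... | no  _ = trans (+-suc _ _) (cong suc (length-filter+length-filter-∁ xs))

map⁺-injectiveOn : ∀ {A B : Set} {f : A → B} {xs} → (∀ {x y} → x ∈ xs → y ∈ xs → f x ≡ f y → x ≡ y) →
  Unique xs → Unique (map f xs)
map⁺-injectiveOn {xs = []}     _     _          = []
map⁺-injectiveOn {xs = x ∷ xs} f-inj (x∉xs ∷ u) =
  All.tabulate (λ fy∈ fx≡fy → let y , y∈xs , fy≡ = ∈-map⁻ _ fy∈ in
    All.lookup x∉xs y∈xs (f-inj (here refl) (there y∈xs) (trans fx≡fy fy≡)))
  ∷ map⁺-injectiveOn (λ x∈ y∈ → f-inj (there x∈) (there y∈)) u

module _ {A B C : Set} (f : A → B → C) where

  dProductWith : List A → (A → List B) → List C
  dProductWith as g = concatMap (λ a → map (f a) (g a)) as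

  ∈-dProductWith⁺ : ∀ {as g a b} → a ∈ as → b ∈ g a → f a b ∈ dProductWith as g
  ∈-dProductWith⁺ {a = a} a∈as b∈ga = ∈-concatMap⁺ _ (lose a∈as (∈-map⁺ (f a) b∈ga))

  ∈-dProductWith⁻ : ∀ {as g c} → c ∈ dProductWith as g →
    ∃₂ λ a b → a ∈ as × b ∈ g a × c ≡ f a b
  ∈-dProductWith⁻ c∈ with a , a∈as , c∈fga ← find (∈-concatMap⁻ _ c∈)
                    with b , b∈ga , refl ← ∈-map⁻ (f a) c∈fga = a , b , a∈as , b∈ga , refl

  length-dProductWith-≤ : ∀ as {g} c → (∀ {a} → a ∈ as → length (g a) ≤ c) →
    length (dProductWith as g) ≤ length as * c
  length-dProductWith-≤ [] c _ = z≤n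
  length-dProductWith-≤ (a ∷ as) {g} c bound = begin
    length (map (f a) (g a) ++ dProductWith as g)      ≡⟨ length-++ (map (f a) (g a)) ⟩
    length (map (f a) (g a)) + length (dProductWith as g)
      ≤⟨ +-mono-≤ (≤-trans (≤-reflexive (length-map (f a) (g a))) (bound (here refl)))
                  (length-dProductWith-≤ as c (bound ∘ there)) ⟩
    c + length as * c                                  ∎
    where open ≤-Reasoning

  length-dProductWith-≥ : ∀ as {g} c → (∀ {a} → a ∈ as → c ≤ length (g a)) →
    length as * c ≤ length (dProductWith as g)
  length-dProductWith-≥ [] c _ = z≤n
  length-dProductWith-≥ (a ∷ as) {g} c bound = begin
    c + length as * c
      ≤⟨ +-mono-≤ (≤-trans (bound (here refl)) (≤-reflexive (sym (length-map (f a) (g a)))))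
                  (length-dProductWith-≥ as c (bound ∘ there)) ⟩
    length (map (f a) (g a)) + length (dProductWith as g) ≡⟨ length-++ (map (f a) (g a)) ⟨
    length (map (f a) (g a) ++ dProductWith as g)      ∎
    where open ≤-Reasoning

  dProductWith⁺ : (∀ {a a′ b b′} → f a b ≡ f a′ b′ → a ≡ a′ × b ≡ b′) →
    ∀ {as g} → Unique as → (∀ a → Unique (g a)) → Unique (dProductWith as g)
  dProductWith⁺ f-inj {[]} _ _ = []
  dProductWith⁺ f-inj {a ∷ as} {g} (a∉as ∷ u) ug =
    Unique.++⁺ (Unique.map⁺ (proj₂ ∘ f-inj) (ug a)) (dProductWith⁺ f-inj u ug) disjoint
    where
    disjoint : ∀ {c} → c ∈ map (f a) (g a) × c ∈ dProductWith as g → ⊥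
    disjoint (c∈fga , c∈rest)
      with b , _ , refl ← ∈-map⁻ (f a) c∈fga
      with a′ , _ , a′∈as , _ , eq ← ∈-dProductWith⁻ c∈rest
      = All.lookup a∉as a′∈as (proj₁ (f-inj eq))

module _ {A : Set} where

  take-++ˡ : ∀ i (xs ys : List A) → i ≤ length xs → take i (xs ++ ys) ≡ take i xs
  take-++ˡ zero    xs       ys _         = refl
  take-++ˡ (suc i) (x ∷ xs) ys (s≤s i≤) = cong (x ∷_) (take-++ˡ i xs ys i≤)

  rotate₁ : List A → List A
  rotate₁ []       = []
  rotate₁ (x ∷ xs) = xs ∷ʳ x

  rotate : ℕ → List A → List A
  rotate zero    xs = xs
  rotate (suc r) xs = rotate r (rotate₁ xs)

  rotate-+ : ∀ r s xs → rotate (r + s) xs ≡ rotate s (rotate r xs)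
  rotate-+ zero    s xs = refl
  rotate-+ (suc r) s xs = rotate-+ r s (rotate₁ xs)

  length-rotate₁ : ∀ xs → length (rotate₁ xs) ≡ length xs
  length-rotate₁ []       = refl
  length-rotate₁ (x ∷ xs) = trans (length-++ xs) (+-comm (length xs) 1)

  length-rotate : ∀ r xs → length (rotate r xs) ≡ length xs
  length-rotate zero    xs = refl
  length-rotate (suc r) xs = trans (length-rotate r (rotate₁ xs)) (length-rotate₁ xs)

  rotate-++ : ∀ xs ys → rotate (length xs) (xs ++ ys) ≡ ys ++ xs
  rotate-++ []       ys = sym (++-identityʳ ys)
  rotate-++ (x ∷ xs) ys = begin
    rotate (length xs) ((xs ++ ys) ∷ʳ x)  ≡⟨ cong (rotate (length xs)) (++-assoc xs ys [ x ]) ⟩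
    rotate (length xs) (xs ++ ys ∷ʳ x)    ≡⟨ rotate-++ xs (ys ∷ʳ x) ⟩
    (ys ∷ʳ x) ++ xs                       ≡⟨ ++-assoc ys [ x ] xs ⟩
    ys ++ x ∷ xs                          ∎
    where open ≡-Reasoning

  rotate-length : ∀ xs → rotate (length xs) xs ≡ xs
  rotate-length xs = begin
    rotate (length xs) xs         ≡⟨ cong (rotate (length xs)) (++-identityʳ xs) ⟨
    rotate (length xs) (xs ++ []) ≡⟨ rotate-++ xs [] ⟩
    xs                            ∎
    where open ≡-Reasoning

  rotate₁-injective : ∀ {xs ys} → rotate₁ xs ≡ rotate₁ ys → xs ≡ ys
  rotate₁-injective {[]}     {[]}     _  = refl
  rotate₁-injective {[]}     {_ ∷ []} ()
  rotate₁-injective {[]}     {_ ∷ _ ∷ _} ()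
  rotate₁-injective {_ ∷ []} {[]} ()
  rotate₁-injective {_ ∷ _ ∷ _} {[]} ()
  rotate₁-injective {x ∷ xs} {y ∷ ys} eq with refl , refl ← ∷ʳ-injective xs ys eq = refl

  rotate-injective : ∀ r {xs ys} → rotate r xs ≡ rotate r ys → xs ≡ ys
  rotate-injective zero    eq = eq
  rotate-injective (suc r) eq = rotate₁-injective (rotate-injective r eq)

  rotate₁⁺ : ∀ {xs} → Unique xs → Unique (rotate₁ xs)
  rotate₁⁺ {[]}     u          = u
  rotate₁⁺ {x ∷ xs} (x∉xs ∷ u) = Unique-∷ʳ u λ x∈xs → All.lookup x∉xs x∈xs refl

  rotate⁺ : ∀ r {xs} → Unique xs → Unique (rotate r xs)
  rotate⁺ zero    u = u
  rotate⁺ (suc r) u = rotate⁺ r (rotate₁⁺ u)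

  take-rotate-++ : ∀ r i (xs ys : List A) → r + i ≤ length xs →
    take i (rotate r (xs ++ ys)) ≡ take i (rotate r xs)
  take-rotate-++ zero    i xs       ys i≤ = take-++ˡ i xs ys i≤
  take-rotate-++ (suc r) i (x ∷ xs) ys (s≤s r+i≤) = begin
    take i (rotate r ((xs ++ ys) ∷ʳ x)) ≡⟨ cong (take i ∘ rotate r) (++-assoc xs ys [ x ]) ⟩
    take i (rotate r (xs ++ ys ∷ʳ x))   ≡⟨ take-rotate-++ r i xs (ys ∷ʳ x) r+i≤ ⟩
    take i (rotate r xs)                ≡⟨ take-rotate-++ r i xs [ x ] r+i≤ ⟨
    take i (rotate r (xs ∷ʳ x))         ∎
    where open ≡-Reasoning

map-rotate : ∀ {A B : Set} (f : A → B) r xs → map f (rotate r xs) ≡ rotate r (map f xs)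
map-rotate f zero    xs       = refl
map-rotate f (suc r) []       = map-rotate f r []
map-rotate f (suc r) (x ∷ xs) = trans (map-rotate f r (xs ∷ʳ x)) (cong (rotate r) (map-++ f xs [ x ]))

rotate-∸ : ∀ {A : Set} j (xs : List A) → j ≤ length xs → rotate (length xs ∸ j) (rotate j xs) ≡ xs
rotate-∸ j xs j≤ = begin
  rotate (length xs ∸ j) (rotate j xs) ≡⟨ rotate-+ j (length xs ∸ j) xs ⟨
  rotate (j + (length xs ∸ j)) xs      ≡⟨ cong (λ r → rotate r xs) (m+[n∸m]≡n j≤) ⟩
  rotate (length xs) xs                ≡⟨ rotate-length xs ⟩
  xs                                   ∎
  where open ≡-Reasoning

module _ {A : Set} (H : List A → Set) where

  OnlyUnrotated : List A → Set
  OnlyUnrotated s = H s × (∀ r → 0 < r → r < length s → ¬ H (rotate r s))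

  rotate-≢-rotate-of-< : ∀ {s s′ j j′} → OnlyUnrotated s → H s′ → length s ≡ length s′ →
    j < j′ → j′ < length s′ → rotate j s ≢ rotate j′ s′
  rotate-≢-rotate-of-< {s} {s′} {j} {j′} (_ , noRotation) Hs′ ∣s∣≡∣s′∣ j<j′ j′<k eq =
    noRotation d 0<d (subst (d <_) (sym ∣s∣≡∣s′∣) d<k) (subst H s′≡ Hs′)
    where
    k = length s′
    d = j + (k ∸ j′)
    s′≡ : s′ ≡ rotate d s
    s′≡ = begin
      s′                             ≡⟨ rotate-∸ j′ s′ (<⇒≤ j′<k) ⟨
      rotate (k ∸ j′) (rotate j′ s′) ≡⟨ cong (rotate (k ∸ j′)) eq ⟨
      rotate (k ∸ j′) (rotate j s)   ≡⟨ rotate-+ j (k ∸ j′) s ⟨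
      rotate d s                     ∎
      where open ≡-Reasoning
    0<d : 0 < d
    0<d = ≤-trans (m<n⇒0<n∸m j′<k) (m≤n+m (k ∸ j′) j)
    d<k : d < k
    d<k = subst (d <_) (m+[n∸m]≡n (<⇒≤ j′<k)) (+-monoˡ-< (k ∸ j′) j<j′)

  OnlyUnrotated-rotation-injective : ∀ {s s′ j j′} → OnlyUnrotated s → OnlyUnrotated s′ →
    j < length s → j′ < length s′ → rotate j s ≡ rotate j′ s′ → j ≡ j′
  OnlyUnrotated-rotation-injective {s} {s′} {j} {j′} os os′ j<k j′<k eq
    with <-cmp j j′ | trans (sym (length-rotate j s)) (trans (cong length eq) (length-rotate j′ s′))
  ... | tri< j<j′ _ _ | ∣s∣≡∣s′∣ =
    ⊥-elim (rotate-≢-rotate-of-< os (proj₁ os′) ∣s∣≡∣s′∣ j<j′ j′<k eq)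
  ... | tri≈ _ j≡j′ _ | _        = j≡j′
  ... | tri> _ _ j′<j | ∣s∣≡∣s′∣ =
    ⊥-elim (rotate-≢-rotate-of-< os′ (proj₁ os) (sym ∣s∣≡∣s′∣) j′<j j<k (sym eq))

  rotate-≢-of-¬H : ∀ {s g j} → (∀ r → ¬ H (rotate r g)) → H s → j ≤ length s → rotate j s ≢ g
  rotate-≢-of-¬H {s} {g} {j} noRotation Hs j≤ eq =
    noRotation (length s ∸ j) (subst H (trans (sym (rotate-∸ j s j≤)) (cong (rotate (length s ∸ j)) eq)) Hs)

₍₎-monoˡ-≤ : ∀ {x y} k → x ≤ y → x ₍ k ₎ ≤ y ₍ k ₎
₍₎-monoˡ-≤ zero    _   = ≤-refl
₍₎-monoˡ-≤ (suc k) x≤y = *-mono-≤ x≤y (₍₎-monoˡ-≤ k (∸-monoˡ-≤ 1 x≤y))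

module _ {A : Set} (_≟_ : DecidableEquality A) where

  without : A → List A → List A
  without x = filter (λ y → ¬? (y ≟ x))

  length-without : ∀ {x U} → x ∈ U → length (without x U) ≤ length U ∸ 1
  length-without {x} {U} x∈U =
    ∸-monoˡ-≤ 1 (filter-notAll (λ y → ¬? (y ≟ x)) U (lose x∈U λ x≢x → x≢x refl))

  arrangements : List A → ℕ → List (List A)
  arrangements U zero    = [ [] ]
  arrangements U (suc k) = dProductWith _∷_ U (λ x → arrangements (without x U) k)

  length-arrangements : ∀ U k → length (arrangements U k) ≤ length U ₍ k ₎
  length-arrangements U zero    = ≤-refl
  length-arrangements U (suc k) = length-dProductWith-≤ _∷_ U ((length U ∸ 1) ₍ k ₎) λ {x} x∈U →
    ≤-trans (length-arrangements (without x U) k) (₍₎-monoˡ-≤ k (length-without x∈U))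

  ∈-arrangements : ∀ {U t} → Unique t → t ⊆ U → t ∈ arrangements U (length t)
  ∈-arrangements {t = []}    _          _     = here refl
  ∈-arrangements {U} {x ∷ t} (x∉t ∷ u) x∷t⊆U =
    ∈-dProductWith⁺ _∷_ (x∷t⊆U (here refl)) (∈-arrangements u t⊆U∖x)
    where
    t⊆U∖x : t ⊆ without x U
    t⊆U∖x y∈t = ∈-filter⁺ _ (x∷t⊆U (there y∈t)) λ y≡x → All.lookup x∉t y∈t (sym y≡x)

  length-≤-₍₎ : ∀ {U k} {ts : List (List A)} → Unique ts →
    (∀ {t} → t ∈ ts → Unique t × t ⊆ U × length t ≡ k) → length ts ≤ length U ₍ k ₎
  length-≤-₍₎ {U} {k} {ts} u arrangement = ≤-trans (Unique⇒length-≤ u ts⊆) (length-arrangements U k)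
    where
    ts⊆ : ts ⊆ arrangements U k
    ts⊆ {t} t∈ts with ut , t⊆U , ∣t∣≡k ← arrangement t∈ts =
      subst (λ m → t ∈ arrangements U m) ∣t∣≡k (∈-arrangements ut t⊆U)

T-does⁺ : ∀ {A : Set} (a? : Dec A) → A → T (does a?)
T-does⁺ (yes _) _ = _
T-does⁺ (no ¬a) a = ¬a a

T-does⁻ : ∀ {A : Set} (a? : Dec A) → T (does a?) → A
T-does⁻ (yes a) _ = a

T-∧⁻ : ∀ {a b} → T (a ∧ b) → T a × T b
T-∧⁻ = Equivalence.to T-∧

T-∧⁺ : ∀ {a b} → T a → T b → T (a ∧ b)
T-∧⁺ ta tb = Equivalence.from T-∧ (ta , tb)

module _ (G : Graph) where
  open Graph G

  distinct⇒Unique : ∀ vs → T (distinct G vs) → Unique vs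
  distinct⇒Unique []       _ = []
  distinct⇒Unique (v ∷ vs) t with fresh , rest ← T-∧⁻ {not _} t =
    All.tabulate (λ w∈vs v≡w →
      T-not fresh (any⁺ (λ w → does (v ≟ᶠ w)) (lose w∈vs (T-does⁺ (v ≟ᶠ _) v≡w))))
      ∷ distinct⇒Unique vs rest
    where
    T-not : ∀ {b} → T (not b) → ¬ T b
    T-not {true} ()

  Unique⇒distinct : ∀ {vs} → Unique vs → T (distinct G vs)
  Unique⇒distinct {[]}     _           = _
  Unique⇒distinct {v ∷ vs} (v∉vs ∷ u) =
    T-∧⁺ (¬T⇒T-not λ t → v∈vs (find (any⁻ _ vs t))) (Unique⇒distinct u)
    where
    ¬T⇒T-not : ∀ {b} → ¬ T b → T (not b)
    ¬T⇒T-not {true}  ¬t = ¬t _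
    ¬T⇒T-not {false} _  = _
    v∈vs : ∃ (λ w → w ∈ vs × T (does (v ≟ᶠ w))) → ⊥
    v∈vs (w , w∈vs , t) = All.lookup v∉vs w∈vs (T-does⁻ (v ≟ᶠ w) t)

  chain-head : ∀ {u v b} → T (adj u v ∧ b) → T (adj u v)
  chain-head t = proj₁ (T-∧⁻ t)

  chain-∷ʳ : ∀ ws {x y} → T (chain G (ws ∷ʳ x)) → T (adj x y) → T (chain G (ws ∷ʳ x ∷ʳ y))
  chain-∷ʳ []           _ xy = T-∧⁺ xy _
  chain-∷ʳ (w ∷ [])     t xy = T-∧⁺ (chain-head t) (T-∧⁺ xy _)
  chain-∷ʳ (w ∷ w′ ∷ ws) t xy = T-∧⁺ (chain-head t) (chain-∷ʳ (w′ ∷ ws) (proj₂ (T-∧⁻ t)) xy)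

  chain-++⁻ : ∀ vs {ws} → T (chain G (vs ++ ws)) → T (chain G vs)
  chain-++⁻ []           _ = _
  chain-++⁻ (v ∷ [])     _ = _
  chain-++⁻ (v ∷ w ∷ vs) t = T-∧⁺ (chain-head t) (chain-++⁻ (w ∷ vs) (proj₂ (T-∧⁻ t)))

  isCycleSeq-rotate₁ : ∀ vs → T (isCycleSeq G vs) → T (isCycleSeq G (rotate₁ vs))
  isCycleSeq-rotate₁ []           t = t
  isCycleSeq-rotate₁ (v ∷ [])     t = t
  isCycleSeq-rotate₁ (v ∷ w ∷ vs) t
    with dist , closed ← T-∧⁻ {distinct G (v ∷ w ∷ vs)} t
    with vw , rest ← T-∧⁻ {adj v w} closed =
    T-∧⁺ (Unique⇒distinct (rotate₁⁺ (distinct⇒Unique (v ∷ w ∷ vs) dist))) (chain-∷ʳ (w ∷ vs) rest vw)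

  CycleSeqs : ℕ → List (List (Fin V))
  CycleSeqs m = filterᵇ (isCycleSeq G) (allSeqs G m)

  allSeqs⁺ : ∀ m → Unique (allSeqs G m)
  allSeqs⁺ zero    = [] ∷ []
  allSeqs⁺ (suc m) = dProductWith⁺ _∷_ ∷-injective (Unique.allFin⁺ V) (λ _ → allSeqs⁺ m)

  ∈-allSeqs⁺ : ∀ vs → vs ∈ allSeqs G (length vs)
  ∈-allSeqs⁺ []       = here refl
  ∈-allSeqs⁺ (v ∷ vs) = ∈-dProductWith⁺ _∷_ (∈-allFin v) (∈-allSeqs⁺ vs)

  ∈-allSeqs⁻ : ∀ m {vs} → vs ∈ allSeqs G m → length vs ≡ m
  ∈-allSeqs⁻ zero    (here refl) = refl
  ∈-allSeqs⁻ (suc m) vs∈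
    with _ , _ , _ , vs′∈ , refl ← ∈-dProductWith⁻ _∷_ {allFin V} {λ _ → allSeqs G m} vs∈ =
    cong suc (∈-allSeqs⁻ m vs′∈)

  ∈-CycleSeqs⁺ : ∀ {vs} → T (isCycleSeq G vs) → vs ∈ CycleSeqs (length vs)
  ∈-CycleSeqs⁺ {vs} t = ∈-filter⁺ (T? ∘ isCycleSeq G) (∈-allSeqs⁺ vs) t

  ∈-CycleSeqs⁻ : ∀ {m vs} → vs ∈ CycleSeqs m → length vs ≡ m × T (isCycleSeq G vs)
  ∈-CycleSeqs⁻ {m} vs∈ with vs∈all , t ← ∈-filter⁻ (T? ∘ isCycleSeq G) vs∈ = ∈-allSeqs⁻ m vs∈all , t

  CycleSeqs⁺ : ∀ m → Unique (CycleSeqs m)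
  CycleSeqs⁺ m = Unique.filter⁺ (T? ∘ isCycleSeq G) (allSeqs⁺ m)

  rotate₁-∈-CycleSeqs : ∀ {m vs} → vs ∈ CycleSeqs m → rotate₁ vs ∈ CycleSeqs m
  rotate₁-∈-CycleSeqs {m} {vs} vs∈ with ∣vs∣≡m , t ← ∈-CycleSeqs⁻ {m} vs∈ =
    subst (λ l → rotate₁ vs ∈ CycleSeqs l) (trans (length-rotate₁ vs) ∣vs∣≡m)
          (∈-CycleSeqs⁺ (isCycleSeq-rotate₁ vs t))

  cycles*-≤ : ∀ m → 3 ≤ m → cycles G m * (2 * m) ≤ cycleSeqCount G m
  cycles*-≤ (suc (suc (suc m))) _ = m/n*n≤m (cycleSeqCount G (3 + m)) (2 * (3 + m))
  cycles*-≤ (suc (suc zero)) (s≤s (s≤s ()))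
  cycles*-≤ (suc zero)       (s≤s ())

  module Bipartite {S : Pred (Fin V) 0ℓ} (S? : Decidable S)
                   (adj-S : ∀ {u v} → T (adj u v) → ¬ S u → S v) where

    StartsIn : List (Fin V) → Set
    StartsIn []      = ⊥
    StartsIn (v ∷ _) = S v

    startsIn? : Decidable StartsIn
    startsIn? []      = no λ ()
    startsIn? (v ∷ _) = S? v

    StartingCycleSeqs : ℕ → List (List (Fin V))
    StartingCycleSeqs m = filter startsIn? (CycleSeqs m)

    StartingCycleSeqs⁺ : ∀ m → Unique (StartingCycleSeqs m)
    StartingCycleSeqs⁺ m = Unique.filter⁺ startsIn? (CycleSeqs⁺ m)

    -- A cycle sequence starting outside S is sent into S by one rotation.
    cycleSeqCount-≤ : ∀ m → 2 ≤ m → cycleSeqCount G m ≤ 2 * length (StartingCycleSeqs m)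
    cycleSeqCount-≤ m 2≤m = begin
      length (CycleSeqs m)                                          ≡⟨ partition ⟨
      length (StartingCycleSeqs m) + length (filter (∁? startsIn?) (CycleSeqs m))
        ≤⟨ +-monoʳ-≤ (length (StartingCycleSeqs m)) others-≤ ⟩
      length (StartingCycleSeqs m) + length (StartingCycleSeqs m)
        ≡⟨ cong (length (StartingCycleSeqs m) +_) (+-identityʳ _) ⟨
      2 * length (StartingCycleSeqs m)                              ∎
      where
      open ≤-Reasoning
      partition = length-filter+length-filter-∁ startsIn? (CycleSeqs m)
      others = filter (∁? startsIn?) (CycleSeqs m)
      rotate₁-others : map rotate₁ others ⊆ StartingCycleSeqs m
      rotate₁-others vs∈ with ws , ws∈ , refl ← ∈-map⁻ rotate₁ vs∈
                         with ws∈cs , ¬S ← ∈-filter⁻ (∁? startsIn?) ws∈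
                         with ∣ws∣≡m , t ← ∈-CycleSeqs⁻ ws∈cs =
        ∈-filter⁺ startsIn? (rotate₁-∈-CycleSeqs {m} ws∈cs)
                  (starts ws (≤-trans 2≤m (≤-reflexive (sym ∣ws∣≡m))) t ¬S)
        where
        starts : ∀ ws → 2 ≤ length ws → T (isCycleSeq G ws) → ¬ StartsIn ws → StartsIn (rotate₁ ws)
        starts (_ ∷ [])     (s≤s ()) _ _
        starts (u ∷ v ∷ ws) _ t ¬Su = adj-S (chain-head (proj₂ (T-∧⁻ {distinct G (u ∷ v ∷ ws)} t))) ¬Su
      others-≤ : length others ≤ length (StartingCycleSeqs m)
      others-≤ = subst (_≤ length (StartingCycleSeqs m)) (length-map rotate₁ others)
        (Unique⇒length-≤ (Unique.map⁺ rotate₁-injective (Unique.filter⁺ (∁? startsIn?) (CycleSeqs⁺ m)))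
                         rotate₁-others)

length-≤-1 : ∀ {A : Set} {xs : List A} → Unique xs → (∀ {x y} → x ∈ xs → y ∈ xs → x ≡ y) →
  length xs ≤ 1
length-≤-1 {xs = []}     _ _     = z≤n
length-≤-1 {xs = x ∷ _} u equal = Unique⇒length-≤ {ys = [ x ]} u λ y∈xs → here (equal y∈xs (here refl))

1+[1+n]*n≡N : ∀ n → 1 + (1 + n) * n ≡ N n
1+[1+n]*n≡N = lemma
  where
  -- N unfolded, since the solver does not look through N and _^_
  lemma : ∀ n → 1 + (1 + n) * n ≡ n * (n * 1) + n + 1
  lemma = solve-∀

module Plane {n : ℕ} (Π : ProjectivePlane n) where
  open ProjectivePlane Π
  open import Data.List.Membership.DecPropositional (_≟ᶠ_ {nP}) using (_∈?_; _∉?_)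

  join-unique : ∀ {x y L M} → x ≢ y → x I L → y I L → x I M → y I M → L ≡ M
  join-unique x≢y xL yL xM yM with _ , _ , unique ← joinLine _ _ x≢y =
    trans (unique _ xL yL) (sym (unique _ xM yM))

  ∈-pointsOn⁺ : ∀ {x L} → x I L → x ∈ pointsOn L
  ∈-pointsOn⁺ {x} {L} xL = ∈-filter⁺ (λ y → T? (does (I? y L))) (∈-allFin x) (T-does⁺ (I? x L) xL)

  ∈-pointsOn⁻ : ∀ {x L} → x ∈ pointsOn L → x I L
  ∈-pointsOn⁻ {x} {L} x∈ =
    T-does⁻ (I? x L) (proj₂ (∈-filter⁻ (λ y → T? (does (I? y L))) {xs = allFin nP} x∈))

  pointsOn⁺ : ∀ L → Unique (pointsOn L)
  pointsOn⁺ L = Unique.filter⁺ (λ y → T? (does (I? y L))) (Unique.allFin⁺ nP)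

  linesThrough : Fin nP → List (Fin nL)
  linesThrough a = filter (I? a) (allFin nL)

  ∈-linesThrough⁺ : ∀ {a L} → a I L → L ∈ linesThrough a
  ∈-linesThrough⁺ {a} {L} aL = ∈-filter⁺ (I? a) (∈-allFin L) aL

  ∈-linesThrough⁻ : ∀ {a L} → L ∈ linesThrough a → a I L
  ∈-linesThrough⁻ {a} L∈ = proj₂ (∈-filter⁻ (I? a) {xs = allFin nL} L∈)

  linesThrough⁺ : ∀ a → Unique (linesThrough a)
  linesThrough⁺ a = Unique.filter⁺ (I? a) (Unique.allFin⁺ nL)

  -- Each line through a meets M in one point, and through that point and a there is one line.
  length-linesThrough-≤ : ∀ {a M} → ¬ a I M → length (linesThrough a) ≤ suc n
  length-linesThrough-≤ {a} {M} a∉M = begin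
    length (linesThrough a)                                 ≤⟨ Unique⇒length-≤ (linesThrough⁺ a) ⊆joins ⟩
    length (dProductWith (λ _ L → L) (pointsOn M) joining)
      ≤⟨ length-dProductWith-≤ _ (pointsOn M) 1 at-most-one ⟩
    length (pointsOn M) * 1                                 ≡⟨ cong (_* 1) (order M) ⟩
    suc n * 1                                               ≡⟨ *-identityʳ (suc n) ⟩
    suc n                                                   ∎
    where
    open ≤-Reasoning
    joining : Fin nP → List (Fin nL)
    joining y = filter (I? y) (linesThrough a)
    ⊆joins : linesThrough a ⊆ dProductWith (λ _ L → L) (pointsOn M) joining
    ⊆joins {L} L∈ with aL ← ∈-linesThrough⁻ L∈
                  with y , (yL , yM) , _ ← meetPoint L M (λ { refl → a∉M aL }) =
      ∈-dProductWith⁺ (λ _ L → L) (∈-pointsOn⁺ yM) (∈-filter⁺ (I? y) L∈ yL)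
    same : ∀ {y L L′} → y ∈ pointsOn M → L ∈ joining y → L′ ∈ joining y → L ≡ L′
    same {y} y∈M L∈ L′∈
      with L∈lt , yL ← ∈-filter⁻ (I? y) {xs = linesThrough a} L∈
         | L′∈lt , yL′ ← ∈-filter⁻ (I? y) {xs = linesThrough a} L′∈ =
      join-unique (λ { refl → a∉M (∈-pointsOn⁻ y∈M) })
                  (∈-linesThrough⁻ L∈lt) yL (∈-linesThrough⁻ L′∈lt) yL′
    at-most-one : ∀ {y} → y ∈ pointsOn M → length (joining y) ≤ 1
    at-most-one {y} y∈M = length-≤-1 (Unique.filter⁺ (I? y) (linesThrough⁺ a)) (same y∈M)

  -- Every point other than a lies on exactly one line through a, next to n other points.
  nP-≤ : ∀ a → nP ≤ suc (length (linesThrough a) * n)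
  nP-≤ a = begin
    nP                                                          ≡⟨ length-tabulate id ⟨
    length (allFin nP)                                          ≤⟨ Unique⇒length-≤ (Unique.allFin⁺ nP) covered ⟩
    length (a ∷ dProductWith (λ _ y → y) (linesThrough a) others)
      ≤⟨ s≤s (length-dProductWith-≤ _ (linesThrough a) n bound) ⟩
    suc (length (linesThrough a) * n)                           ∎
    where
    open ≤-Reasoning
    others : Fin nL → List (Fin nP)
    others L = without _≟ᶠ_ a (pointsOn L)
    covered : allFin nP ⊆ a ∷ dProductWith (λ _ y → y) (linesThrough a) others
    covered {y} _ with y ≟ᶠ a
    ... | yes y≡a = here y≡a
    ... | no y≢a with L , (yL , aL) , _ ← joinLine y a y≢a =
      there (∈-dProductWith⁺ (λ _ y → y) (∈-linesThrough⁺ aL) (∈-filter⁺ _ (∈-pointsOn⁺ yL) y≢a))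
    bound : ∀ {L} → L ∈ linesThrough a → length (others L) ≤ n
    bound {L} L∈ = subst (length (others L) ≤_) (cong (_∸ 1) (order L))
                         (length-without _≟ᶠ_ (∈-pointsOn⁺ (∈-linesThrough⁻ L∈)))

  nP≤N : nP ≤ N n
  nP≤N with a , b , c , _ , ¬abc , _ ← quadrangle = begin
    nP                                 ≤⟨ nP-≤ a ⟩
    suc (length (linesThrough a) * n)  ≤⟨ s≤s (*-monoˡ-≤ n linesThrough-≤) ⟩
    1 + (1 + n) * n                    ≡⟨ 1+[1+n]*n≡N n ⟩
    N n                                ∎
    where
    open ≤-Reasoning
    linesThrough-≤ : length (linesThrough a) ≤ suc n
    linesThrough-≤ with b ≟ᶠ c
    ... | no b≢c with M , (bM , cM) , _ ← joinLine b c b≢c =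
      length-linesThrough-≤ λ aM → ¬abc (M , aM , bM , cM)
    ... | yes refl =
      ≤-trans (Unique⇒length-≤ {ys = []} (linesThrough⁺ a) (⊥-elim ∘ noLine ∘ ∈-linesThrough⁻)) z≤n
      where
      noLine : ∀ {L} → a I L → ⊥
      noLine {L} aL with a ≟ᶠ b
      ... | yes refl = ¬abc (L , aL , aL , aL)
      ... | no a≢b with M , (aM , bM) , _ ← joinLine a b a≢b = ¬abc (M , aM , bM , bM)

  CollinearTriple : List (Fin nP) → Set
  CollinearTriple (x ∷ y ∷ z ∷ []) = Collinear x y z
  CollinearTriple _                = ⊥

  HeadCollinear : List (Fin nP) → Set
  HeadCollinear xs = CollinearTriple (take 3 xs)

  Polygon : List (Fin nP) → Set
  Polygon qs = ∀ r → ¬ HeadCollinear (rotate r qs)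

  extensions : List (Fin nP) → List (Fin nP)
  extensions qs@(q₁ ∷ q₂ ∷ _) with q₁ ≟ᶠ q₂
  ... | yes _    = []
  ... | no q₁≢q₂ = filter (_∉? qs) (pointsOn (proj₁ (joinLine q₁ q₂ q₁≢q₂)))
  extensions _ = []

  ∈-extensions⁻ : ∀ {q₁ q₂ rest x} → x ∈ extensions (q₁ ∷ q₂ ∷ rest) →
    x ∉ q₁ ∷ q₂ ∷ rest × Collinear q₁ q₂ x
  ∈-extensions⁻ {q₁} {q₂} {rest} x∈ with q₁ ≟ᶠ q₂
  ... | no q₁≢q₂ with L , (q₁L , q₂L) , _ ← joinLine q₁ q₂ q₁≢q₂
                 with x∈L , x∉ ← ∈-filter⁻ (_∉? q₁ ∷ q₂ ∷ rest) {xs = pointsOn L} x∈ =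
    x∉ , L , q₁L , q₂L , ∈-pointsOn⁻ x∈L

  length-outside : ∀ L qs → suc n ∸ length qs ≤ length (filter (_∉? qs) (pointsOn L))
  length-outside L qs = begin
    suc n ∸ length qs             ≤⟨ ∸-monoʳ-≤ (suc n) inside-≤ ⟩
    suc n ∸ length inside         ≡⟨ cong (_∸ length inside) partition ⟨
    length outside + length inside ∸ length inside ≡⟨ m+n∸n≡m (length outside) (length inside) ⟩
    length outside                ∎
    where
    open ≤-Reasoning
    outside = filter (_∉? qs) (pointsOn L)
    inside  = filter (∁? (_∉? qs)) (pointsOn L)
    partition : length outside + length inside ≡ suc n
    partition = trans (length-filter+length-filter-∁ (_∉? qs) (pointsOn L)) (order L)
    inside-≤ : length inside ≤ length qs
    inside-≤ = Unique⇒length-≤ (Unique.filter⁺ (∁? (_∉? qs)) (pointsOn⁺ L)) λ {x} x∈ →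
      decidable-stable (x ∈? qs) (proj₂ (∈-filter⁻ (∁? (_∉? qs)) {xs = pointsOn L} x∈))

  length-extensions : ∀ {qs} → Unique qs → 2 ≤ length qs → suc n ∸ length qs ≤ length (extensions qs)
  length-extensions {_ ∷ []} _ (s≤s ())
  length-extensions {q₁ ∷ q₂ ∷ rest} ((q₁≢q₂ ∷ _) ∷ _) _ with q₁ ≟ᶠ q₂
  ... | yes q₁≡q₂ = ⊥-elim (q₁≢q₂ q₁≡q₂)
  ... | no q₁≢q₂′ = length-outside (proj₁ (joinLine q₁ q₂ q₁≢q₂′)) (q₁ ∷ q₂ ∷ rest)

  extensions⁺ : ∀ qs → Unique (extensions qs)
  extensions⁺ []            = []
  extensions⁺ (_ ∷ [])      = []
  extensions⁺ qs@(q₁ ∷ q₂ ∷ _) with q₁ ≟ᶠ q₂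
  ... | yes _    = []
  ... | no q₁≢q₂ = Unique.filter⁺ (_∉? qs) (pointsOn⁺ (proj₁ (joinLine q₁ q₂ q₁≢q₂)))

  -- The triple (b, q₁, x) wrapping around the end, b the last point of the polygon.
  wrap-not-collinear : ∀ {q₁ q₂ x L} rest → 1 ≤ length rest →
    ¬ HeadCollinear (rotate (suc (length rest)) (q₁ ∷ q₂ ∷ rest)) →
    q₁ I L → q₂ I L → x I L → x ≢ q₁ →
    ¬ HeadCollinear (rotate (suc (suc (length rest))) (q₁ ∷ x ∷ q₂ ∷ rest))
  wrap-not-collinear {q₁} {q₂} {x} {L} rest 1≤ ¬bq₁q₂ q₁L q₂L xL x≢q₁ with initLast rest
  ... | [] = ⊥-elim (1+n≰n 1≤)
  ... | ps ∷ʳ′ b = λ bq₁x →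
    ¬bq₁q₂ (subst HeadCollinear (sym wrapped) (bq₂ (subst HeadCollinear wrapped′ bq₁x)))
    where
    ∣ps∷ʳb∣ : length (ps ∷ʳ b) ≡ suc (length ps)
    ∣ps∷ʳb∣ = trans (length-++ ps) (+-comm (length ps) 1)
    wrapped : rotate (suc (length (ps ∷ʳ b))) (q₁ ∷ q₂ ∷ ps ∷ʳ b) ≡ b ∷ q₁ ∷ q₂ ∷ ps
    wrapped = trans (cong (λ r → rotate (suc r) (q₁ ∷ q₂ ∷ ps ∷ʳ b)) ∣ps∷ʳb∣)
                    (rotate-++ (q₁ ∷ q₂ ∷ ps) [ b ])
    wrapped′ : rotate (suc (suc (length (ps ∷ʳ b)))) (q₁ ∷ x ∷ q₂ ∷ ps ∷ʳ b) ≡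
               b ∷ q₁ ∷ x ∷ q₂ ∷ ps
    wrapped′ = trans (cong (λ r → rotate (suc (suc r)) (q₁ ∷ x ∷ q₂ ∷ ps ∷ʳ b)) ∣ps∷ʳb∣)
                     (rotate-++ (q₁ ∷ x ∷ q₂ ∷ ps) [ b ])
    bq₂ : Collinear b q₁ x → Collinear b q₁ q₂
    bq₂ (K , bK , q₁K , xK) with refl ← join-unique x≢q₁ xK q₁K xL q₁L = K , bK , q₁L , q₂L

  insert-OnlyUnrotated : ∀ {q₁ q₂ q₃ x} rest → Polygon (q₁ ∷ q₂ ∷ q₃ ∷ rest) →
    x ∉ q₁ ∷ q₂ ∷ q₃ ∷ rest → Collinear q₁ q₂ x →
    OnlyUnrotated HeadCollinear (q₁ ∷ x ∷ q₂ ∷ q₃ ∷ rest)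
  insert-OnlyUnrotated {q₁} {q₂} {q₃} {x} rest polygon x∉ (L , q₁L , q₂L , xL) =
    (L , q₁L , xL , q₂L) , proper
    where
    x≢q₁ : x ≢ q₁
    x≢q₁ refl = x∉ (here refl)
    x≢q₂ : x ≢ q₂
    x≢q₂ refl = x∉ (there (here refl))
    ∣rest∷ʳq₁∣ : length (rest ∷ʳ q₁) ≡ suc (length rest)
    ∣rest∷ʳq₁∣ = trans (length-++ rest) (+-comm (length rest) 1)
    proper : ∀ r → 0 < r → r < length (q₁ ∷ x ∷ q₂ ∷ q₃ ∷ rest) →
      ¬ HeadCollinear (rotate r (q₁ ∷ x ∷ q₂ ∷ q₃ ∷ rest))
    proper 1 _ _ (K , xK , q₂K , q₃K) with refl ← join-unique x≢q₂ xK q₂K xL q₂L =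
      polygon 0 (K , q₁L , q₂L , q₃K)
    proper (suc (suc r)) _ (s≤s (s≤s (s≤s r≤))) with r <? length (q₃ ∷ rest)
    ... | yes r<∣rest∣ = polygon (suc r) ∘ subst CollinearTriple (take-rotate-++ r 3 _ [ x ] fits)
      where
      fits : r + 3 ≤ length ((q₂ ∷ q₃ ∷ rest) ∷ʳ q₁)
      fits = subst (_≤ length ((q₂ ∷ q₃ ∷ rest) ∷ʳ q₁)) (+-comm 3 r)
                   (s≤s (s≤s (≤-trans r<∣rest∣ (≤-reflexive (sym ∣rest∷ʳq₁∣)))))
    ... | no r≮∣rest∣ with refl ← ≤-antisym r≤ (≮⇒≥ r≮∣rest∣) =
      wrap-not-collinear (q₃ ∷ rest) (s≤s z≤n) (polygon (suc (length (q₃ ∷ rest)))) q₁L q₂L xL x≢q₁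

module LeviCycles {n : ℕ} (Π : ProjectivePlane n) where
  open ProjectivePlane Π
  open Plane Π
  open Graph (Levi Π) using (V; adj)

  point : Fin nP → Fin V
  point x = x ↑ˡ nL

  line : Fin nL → Fin V
  line L = nP ↑ʳ L

  data Kind : Fin V → Set where
    point-kind : ∀ x → Kind (point x)
    line-kind  : ∀ L → Kind (line L)

  kind : ∀ v → Kind v
  kind v with splitAt nP v in eq
  ... | inj₁ x = subst Kind (splitAt⁻¹-↑ˡ eq) (point-kind x)
  ... | inj₂ L = subst Kind (splitAt⁻¹-↑ʳ eq) (line-kind L)

  adj-point-line⁻ : ∀ {x L} → T (adj (point x) (line L)) → x I L
  adj-point-line⁻ {x} {L} t rewrite splitAt-↑ˡ nP x nL | splitAt-↑ʳ nP nL L = T-does⁻ (I? x L) t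

  adj-line-point⁻ : ∀ {x L} → T (adj (line L) (point x)) → x I L
  adj-line-point⁻ {x} {L} t rewrite splitAt-↑ˡ nP x nL | splitAt-↑ʳ nP nL L = T-does⁻ (I? x L) t

  point-adj⁻ : ∀ {x v} → T (adj (point x) v) → ∃ λ L → v ≡ line L
  point-adj⁻ {x} {v} t with kind v
  ... | line-kind L  = L , refl
  ... | point-kind y rewrite splitAt-↑ˡ nP x nL | splitAt-↑ˡ nP y nL = ⊥-elim t

  line-adj⁻ : ∀ {L v} → T (adj (line L) v) → ∃ λ x → v ≡ point x
  line-adj⁻ {L} {v} t with kind v
  ... | point-kind x = x , refl
  ... | line-kind M rewrite splitAt-↑ʳ nP nL L | splitAt-↑ʳ nP nL M = ⊥-elim t

  IsPoint : Fin V → Set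
  IsPoint v = ∃ λ x → v ≡ point x

  isPoint? : Decidable IsPoint
  isPoint? v with kind v
  ... | point-kind x = yes (x , refl)
  ... | line-kind L  = no λ (x , eq) → point≢line (sym eq)
    where
    point≢line : ∀ {x} → point x ≢ line L
    point≢line {x} eq
      with () ← trans (sym (splitAt-↑ˡ nP x nL)) (trans (cong (splitAt nP) eq) (splitAt-↑ʳ nP nL L))

  adj-IsPoint : ∀ {u v} → T (adj u v) → ¬ IsPoint u → IsPoint v
  adj-IsPoint {u} t ¬Pu with kind u
  ... | point-kind x = ⊥-elim (¬Pu (x , refl))
  ... | line-kind L  = line-adj⁻ t

  open Bipartite (Levi Π) isPoint? adj-IsPoint public
    renaming ( StartingCycleSeqs to PointCycleSeqs; StartingCycleSeqs⁺ to PointCycleSeqs⁺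
             ; cycleSeqCount-≤ to cycleSeqCount-≤-PointCycleSeqs)

  Flag : Set
  Flag = Fin nP × Fin nL

  vertices : List Flag → List (Fin V)
  vertices []             = []
  vertices ((x , L) ∷ fs) = point x ∷ line L ∷ vertices fs

  points : List Flag → List (Fin nP)
  points = map proj₁

  lines : List Flag → List (Fin nL)
  lines = map proj₂

  nextPoint : List Flag → Fin nP → Fin nP
  nextPoint []            z = z
  nextPoint ((y , _) ∷ _) _ = y

  Closed : List Flag → Fin nP → Set
  Closed []             z = ⊤
  Closed ((x , L) ∷ fs) z = x I L × nextPoint fs z I L × Closed fs z

  IsFlagCycle : List Flag → Set
  IsFlagCycle fs = T (isCycleSeq (Levi Π) (vertices fs))

  chain⇒Closed : ∀ fs {z} → T (chain (Levi Π) (vertices fs ∷ʳ point z)) → Closed fs z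
  chain⇒Closed []                        _ = _
  chain⇒Closed ((x , L) ∷ [])            t =
    let xL , Lz = T-∧⁻ {adj (point x) (line L)} t
    in adj-point-line⁻ xL , adj-line-point⁻ (chain-head (Levi Π) Lz) , _
  chain⇒Closed ((x , L) ∷ (y , M) ∷ fs) t =
    let xL , Ly… = T-∧⁻ {adj (point x) (line L)} t
        yL , rest = T-∧⁻ {adj (line L) (point y)} Ly…
    in adj-point-line⁻ xL , adj-line-point⁻ yL , chain⇒Closed ((y , M) ∷ fs) rest

  record FlagCycle (fs : List Flag) : Set where
    field
      closed  : ∀ {z} → Closed fs (nextPoint fs z)
      points⁺ : Unique (points fs)
      lines⁺  : Unique (lines fs)

  IsFlagCycle⇒FlagCycle : ∀ fs → IsFlagCycle fs → FlagCycle fs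
  IsFlagCycle⇒FlagCycle fs t = record
    { closed  = closed fs (proj₂ (T-∧⁻ {distinct (Levi Π) (vertices fs)} t))
    ; points⁺ = proj₁ (vertices⁻ fs u)
    ; lines⁺  = proj₂ (vertices⁻ fs u)
    }
    where
    closed : ∀ fs {z} → T (cyclicChain (Levi Π) (vertices fs)) → Closed fs (nextPoint fs z)
    closed []             _ = _
    closed ((x , L) ∷ fs) c = chain⇒Closed ((x , L) ∷ fs) c
    u : Unique (vertices fs)
    u = distinct⇒Unique (Levi Π) (vertices fs) (proj₁ (T-∧⁻ {distinct (Levi Π) (vertices fs)} t))
    ∈-point : ∀ fs {y} → y ∈ points fs → point y ∈ vertices fs
    ∈-point (_ ∷ fs) (here refl) = here refl
    ∈-point (_ ∷ fs) (there y∈)  = there (there (∈-point fs y∈))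
    ∈-line : ∀ fs {M} → M ∈ lines fs → line M ∈ vertices fs
    ∈-line (_ ∷ fs) (here refl) = there (here refl)
    ∈-line (_ ∷ fs) (there M∈)  = there (there (∈-line fs M∈))
    vertices⁻ : ∀ fs → Unique (vertices fs) → Unique (points fs) × Unique (lines fs)
    vertices⁻ []             _             = [] , []
    vertices⁻ ((x , L) ∷ fs) (x∉ ∷ L∉ ∷ u) =
      All.tabulate (λ y∈ x≡y → All.lookup x∉ (there (∈-point fs y∈)) (cong point x≡y))
        ∷ proj₁ (vertices⁻ fs u) ,
      All.tabulate (λ M∈ L≡M → All.lookup L∉ (∈-line fs M∈) (cong line L≡M))
        ∷ proj₂ (vertices⁻ fs u)

  vertices-rotate₁ : ∀ fs → vertices (rotate₁ fs) ≡ rotate₁ (rotate₁ (vertices fs))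
  vertices-rotate₁ []             = refl
  vertices-rotate₁ ((x , L) ∷ fs) = begin
    vertices (fs ∷ʳ (x , L))                   ≡⟨ vertices-++ fs ⟩
    vertices fs ++ point x ∷ line L ∷ []       ≡⟨ ++-assoc (vertices fs) [ point x ] [ line L ] ⟨
    vertices fs ∷ʳ point x ∷ʳ line L           ∎
    where
    open ≡-Reasoning
    vertices-++ : ∀ fs {gs} → vertices (fs ++ gs) ≡ vertices fs ++ vertices gs
    vertices-++ []             = refl
    vertices-++ ((y , M) ∷ fs) = cong (λ vs → point y ∷ line M ∷ vs) (vertices-++ fs)

  IsFlagCycle-rotate : ∀ r {fs} → IsFlagCycle fs → IsFlagCycle (rotate r fs)
  IsFlagCycle-rotate zero    t = t
  IsFlagCycle-rotate (suc r) {fs} t = IsFlagCycle-rotate r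
    (subst (T ∘ isCycleSeq (Levi Π)) (sym (vertices-rotate₁ fs))
           (isCycleSeq-rotate₁ (Levi Π) (rotate₁ (vertices fs)) (isCycleSeq-rotate₁ (Levi Π) (vertices fs) t)))

  -- Consecutive flags have distinct lines through their common point.
  IsFlagCycle⇒Polygon : ∀ {fs} → 3 ≤ length fs → IsFlagCycle fs → Polygon (points fs)
  IsFlagCycle⇒Polygon {fs} 3≤ t r = subst (¬_ ∘ HeadCollinear) (map-rotate proj₁ r fs)
    (head-not-collinear (rotate r fs) (subst (3 ≤_) (sym (length-rotate r fs)) 3≤)
      (IsFlagCycle⇒FlagCycle (rotate r fs) (IsFlagCycle-rotate r t)))
    where
    head-not-collinear : ∀ gs → 3 ≤ length gs → FlagCycle gs → ¬ HeadCollinear (points gs)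
    head-not-collinear ((x₀ , L₀) ∷ (x₁ , L₁) ∷ (x₂ , L₂) ∷ gs) _ fc = noncollinear (closed {x₀})
      where
      open FlagCycle fc
      noncollinear : Closed ((x₀ , L₀) ∷ (x₁ , L₁) ∷ (x₂ , L₂) ∷ gs) x₀ → ¬ Collinear x₀ x₁ x₂
      noncollinear (x₀L₀ , x₁L₀ , x₁L₁ , x₂L₁ , _) (K , x₀K , x₁K , x₂K) =
        All.head (AllPairs.head lines⁺)
          (trans (join-unique (All.head (AllPairs.head points⁺)) x₀L₀ x₁L₀ x₀K x₁K)
                 (join-unique (All.head (AllPairs.head (AllPairs.tail points⁺))) x₁K x₂K x₁L₁ x₂L₁))

  -- Each line of a flag cycle is the join of two distinct consecutive points.
  FlagCycle-injective : ∀ {fs gs} → 2 ≤ length fs → FlagCycle fs → FlagCycle gs →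
    points fs ≡ points gs → fs ≡ gs
  FlagCycle-injective {(x , L) ∷ fs} {gs} 2≤ fc gc eq =
    Closed-injective (FlagCycle.closed fc {x})
      (subst (Closed gs) (sym (nextPoint-cong {(x , L) ∷ fs} {gs} eq)) (FlagCycle.closed gc {x}))
      (linked fs 2≤ (FlagCycle.points⁺ fc)) eq
    where
    linked : ∀ fs → 2 ≤ suc (length fs) → Unique (points ((x , L) ∷ fs)) →
      Linked _≢_ (points ((x , L) ∷ fs) ∷ʳ x)
    linked []      (s≤s ()) _
    linked (_ ∷ _) _        u = Unique⇒cyclically-Linked u
    nextPoint-cong : ∀ {fs gs z} → points fs ≡ points gs → nextPoint fs z ≡ nextPoint gs z
    nextPoint-cong {[]}    {[]}    _  = refl
    nextPoint-cong {_ ∷ _} {_ ∷ _} eq = proj₁ (∷-injective eq)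
    linked-next : ∀ {y} fs {z} → Linked _≢_ (y ∷ points fs ∷ʳ z) → y ≢ nextPoint fs z
    linked-next []      l = Linked.head l
    linked-next (_ ∷ _) l = Linked.head l
    Closed-injective : ∀ {fs gs z} → Closed fs z → Closed gs z → Linked _≢_ (points fs ∷ʳ z) →
      points fs ≡ points gs → fs ≡ gs
    Closed-injective {[]}    {[]}    _ _ _ _ = refl
    Closed-injective {(y , M) ∷ fs} {(y′ , M′) ∷ gs} (yM , nM , c) (y′M′ , nM′ , c′) l eq
      with refl ← proj₁ (∷-injective eq) =
      cong₂ (λ N hs → (y , N) ∷ hs)
        (join-unique (linked-next fs l) yM nM y′M′
                     (subst (_I M′) (sym (nextPoint-cong (proj₂ (∷-injective eq)))) nM′))
        (Closed-injective c c′ (Linked.tail l) (proj₂ (∷-injective eq)))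

  alternating : ∀ m {x vs} → length (point x ∷ vs) ≡ m + m → T (chain (Levi Π) (point x ∷ vs)) →
    ∃ λ fs → point x ∷ vs ≡ vertices fs × length fs ≡ m
  alternating (suc m) {x} {[]} ∣vs∣ _ with () ← trans (suc-injective ∣vs∣) (+-suc m m)
  alternating (suc m) {x} {w ∷ vs} ∣vs∣ t with L , refl ← point-adj⁻ (chain-head (Levi Π) t) | vs
  ... | [] = ((x , L) ∷ []) , refl , cong suc (0≡m m (suc-injective ∣vs∣))
    where
    0≡m : ∀ m → 1 ≡ m + suc m → 0 ≡ m
    0≡m zero    _  = refl
    0≡m (suc m) eq with () ← trans (suc-injective eq) (+-suc m (suc m))
  ... | u ∷ vs′
    with y , refl ← line-adj⁻ {L} {u} (chain-head (Levi Π) (proj₂ (T-∧⁻ {adj (point x) (line L)} t)))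
    with fs , eq , ∣fs∣ ← alternating m {y} {vs′} (suc-injective (trans (suc-injective ∣vs∣) (+-suc m m)))
                            (proj₂ (T-∧⁻ {adj (line L) (point y)} (proj₂ (T-∧⁻ {adj (point x) (line L)} t)))) =
    ((x , L) ∷ fs) , cong (λ vs → point x ∷ line L ∷ vs) eq , cong suc ∣fs∣

  ∈-PointCycleSeqs⁻ : ∀ m {vs} → vs ∈ PointCycleSeqs (m + m) →
    ∃ λ fs → vs ≡ vertices fs × length fs ≡ m × IsFlagCycle fs
  ∈-PointCycleSeqs⁻ m {vs} vs∈ = decode vs (proj₂ starts) (∈-CycleSeqs⁻ (Levi Π) (proj₁ starts))
    where
    starts = ∈-filter⁻ startsIn? {xs = CycleSeqs (Levi Π) (m + m)} vs∈
    decode : ∀ vs → StartsIn vs → length vs ≡ m + m × T (isCycleSeq (Levi Π) vs) →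
      ∃ λ fs → vs ≡ vertices fs × length fs ≡ m × IsFlagCycle fs
    decode (_ ∷ vs) (x , refl) (∣vs∣ , t) =
      let fs , eq , ∣fs∣ = alternating m ∣vs∣ (chain-++⁻ (Levi Π) (point x ∷ vs) (proj₂ (T-∧⁻ t)))
      in fs , eq , ∣fs∣ , subst (T ∘ isCycleSeq (Levi Π)) eq t

  pointOf : Fin V → Maybe (Fin nP)
  pointOf v = [ just , const nothing ]′ (splitAt nP v)

  pointsOf : List (Fin V) → List (Fin nP)
  pointsOf = mapMaybe pointOf

  pointsOf-vertices : ∀ fs → pointsOf (vertices fs) ≡ points fs
  pointsOf-vertices []             = refl
  pointsOf-vertices ((x , L) ∷ fs) rewrite splitAt-↑ˡ nP x nL | splitAt-↑ʳ nP nL L =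
    cong (x ∷_) (pointsOf-vertices fs)

  module _ m {vs} (vs∈ : vs ∈ PointCycleSeqs (m + m)) where

    flagsOf : List Flag
    flagsOf = proj₁ (∈-PointCycleSeqs⁻ m vs∈)

    vs≡vertices-flagsOf : vs ≡ vertices flagsOf
    vs≡vertices-flagsOf = proj₁ (proj₂ (∈-PointCycleSeqs⁻ m vs∈))

    length-flagsOf : length flagsOf ≡ m
    length-flagsOf = proj₁ (proj₂ (proj₂ (∈-PointCycleSeqs⁻ m vs∈)))

    flagsOf-IsFlagCycle : IsFlagCycle flagsOf
    flagsOf-IsFlagCycle = proj₂ (proj₂ (proj₂ (∈-PointCycleSeqs⁻ m vs∈)))

    pointsOf≡points-flagsOf : pointsOf vs ≡ points flagsOf
    pointsOf≡points-flagsOf = trans (cong pointsOf vs≡vertices-flagsOf) (pointsOf-vertices flagsOf)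

    pointsOf⁺ : Unique (pointsOf vs)
    pointsOf⁺ = subst Unique (sym pointsOf≡points-flagsOf)
      (FlagCycle.points⁺ (IsFlagCycle⇒FlagCycle flagsOf flagsOf-IsFlagCycle))

    length-pointsOf : length (pointsOf vs) ≡ m
    length-pointsOf = trans (cong length pointsOf≡points-flagsOf) (trans (length-map proj₁ flagsOf) length-flagsOf)

    pointsOf-Polygon : 3 ≤ m → Polygon (pointsOf vs)
    pointsOf-Polygon 3≤m = subst Polygon (sym pointsOf≡points-flagsOf)
      (IsFlagCycle⇒Polygon (≤-trans 3≤m (≤-reflexive (sym length-flagsOf))) flagsOf-IsFlagCycle)

  pointsOf-injective : ∀ {m vs vs′} → 2 ≤ m → vs ∈ PointCycleSeqs (m + m) → vs′ ∈ PointCycleSeqs (m + m) →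
    pointsOf vs ≡ pointsOf vs′ → vs ≡ vs′
  pointsOf-injective {m} {vs} {vs′} 2≤m vs∈ vs′∈ eq = begin
    vs        ≡⟨ vs≡vertices-flagsOf m vs∈ ⟩
    vertices fs ≡⟨ cong vertices (FlagCycle-injective (≤-trans 2≤m (≤-reflexive (sym (length-flagsOf m vs∈))))
                    (IsFlagCycle⇒FlagCycle fs (flagsOf-IsFlagCycle m vs∈))
                    (IsFlagCycle⇒FlagCycle gs (flagsOf-IsFlagCycle m vs′∈))
                    (trans (sym (pointsOf≡points-flagsOf m vs∈)) (trans eq (pointsOf≡points-flagsOf m vs′∈)))) ⟩
    vertices gs ≡⟨ vs≡vertices-flagsOf m vs′∈ ⟨
    vs′       ∎
    where
    open ≡-Reasoning
    fs gs : List Flag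
    fs = flagsOf m vs∈
    gs = flagsOf m vs′∈

  *-cycles-≤ : ∀ M → 3 ≤ M → M * cycles (Levi Π) M ≤ length (PointCycleSeqs M)
  *-cycles-≤ M 3≤M = *-cancelˡ-≤ 2 (begin
    2 * (M * c)                        ≡⟨ *-assoc 2 M c ⟨
    2 * M * c                          ≡⟨ *-comm (2 * M) c ⟩
    c * (2 * M)                        ≤⟨ cycles*-≤ (Levi Π) M 3≤M ⟩
    cycleSeqCount (Levi Π) M           ≤⟨ cycleSeqCount-≤-PointCycleSeqs M (≤-trans (n≤1+n 2) 3≤M) ⟩
    2 * length (PointCycleSeqs M)      ∎)
    where
    open ≤-Reasoning
    c = cycles (Levi Π) M

module Counting {n : ℕ} (Π : ProjectivePlane n) {m : ℕ} (3≤m : 3 ≤ m) (m<n : m < n) where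
  open ProjectivePlane Π
  open Plane Π
  open LeviCycles Π
  open Graph (Levi Π) using (V)

  k c : ℕ
  k = suc m
  c = n ∸ k + 2

  CyclesK CyclesM : List (List (Fin V))
  CyclesK = PointCycleSeqs (k + k)
  CyclesM = PointCycleSeqs (m + m)

  Seeds : List (List (Fin V) × Fin nP)
  Seeds = dProductWith _,_ CyclesM (extensions ∘ pointsOf)

  Tagged : List (ℕ × List (Fin V) × Fin nP)
  Tagged = dProductWith _,_ (upTo k) (λ _ → Seeds)

  build : ℕ × List (Fin V) × Fin nP → List (Fin nP)
  build (j , w , x) = rotate j (insertSecond x (pointsOf w))

  c≡suc[n]∸m : c ≡ suc n ∸ m
  c≡suc[n]∸m = begin
    d + 2                   ≡⟨ +-comm d 2 ⟩
    2 + d                   ≡⟨ m+n∸m≡n m (2 + d) ⟨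
    m + (2 + d) ∸ m         ≡⟨ cong (_∸ m) (trans (+-suc m (suc d)) (cong suc (+-suc m d))) ⟩
    suc (suc m + d) ∸ m     ≡⟨ cong (λ l → suc l ∸ m) (m+[n∸m]≡n m<n) ⟩
    suc n ∸ m               ∎
    where
    open ≡-Reasoning
    d = n ∸ k

  module _ {w x} (w∈ : w ∈ CyclesM) (x∈ : x ∈ extensions (pointsOf w)) where

    private
      insert : ∀ {qs} → Unique qs → 3 ≤ length qs → Polygon qs → x ∈ extensions qs →
        OnlyUnrotated HeadCollinear (insertSecond x qs) × Unique (insertSecond x qs)
      insert {_ ∷ _ ∷ []} _ (s≤s (s≤s ())) _ _
      insert {q₁ ∷ q₂ ∷ q₃ ∷ rest} u _ polygon x∈ with x∉ , col ← ∈-extensions⁻ x∈ =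
        insert-OnlyUnrotated rest polygon x∉ col , insertSecond⁺ u x∉

      inserted = insert (pointsOf⁺ m w∈) (≤-trans 3≤m (≤-reflexive (sym (length-pointsOf m w∈))))
                        (pointsOf-Polygon m w∈ 3≤m) x∈

    seed-OnlyUnrotated : OnlyUnrotated HeadCollinear (insertSecond x (pointsOf w))
    seed-OnlyUnrotated = proj₁ inserted

    seed⁺ : Unique (insertSecond x (pointsOf w))
    seed⁺ = proj₂ inserted

    length-seed : length (insertSecond x (pointsOf w)) ≡ k
    length-seed = trans (length-insertSecond x (pointsOf w)) (cong suc (length-pointsOf m w∈))

  ∈-Tagged⁻ : ∀ {t} → t ∈ Tagged →
    ∃₂ λ j w → ∃ λ x → t ≡ (j , w , x) × j < k × w ∈ CyclesM × x ∈ extensions (pointsOf w)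
  ∈-Tagged⁻ t∈ with j , wx , j∈ , wx∈ , refl ← ∈-dProductWith⁻ _,_ {upTo k} {λ _ → Seeds} t∈
               with w , x , w∈ , x∈ , refl ← ∈-dProductWith⁻ _,_ {CyclesM} {extensions ∘ pointsOf} wx∈ =
    j , w , x , refl , ∈-upTo⁻ j∈ , w∈ , x∈

  -- The only collinear triple of a seed sits at its start, so its rotation index is recoverable.
  build-injective : ∀ {t t′} → t ∈ Tagged → t′ ∈ Tagged → build t ≡ build t′ → t ≡ t′
  build-injective t∈ t′∈ eq
    with j , w , x , refl , j<k , w∈ , x∈ ← ∈-Tagged⁻ t∈
       | j′ , w′ , x′ , refl , j′<k , w′∈ , x′∈ ← ∈-Tagged⁻ t′∈
    with refl ← OnlyUnrotated-rotation-injective HeadCollinear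
                  (seed-OnlyUnrotated w∈ x∈) (seed-OnlyUnrotated w′∈ x′∈)
                  (subst (j <_) (sym (length-seed w∈ x∈)) j<k)
                  (subst (j′ <_) (sym (length-seed w′∈ x′∈)) j′<k) eq
    with refl , points≡ ← insertSecond-injective (rotate-injective j eq)
    with refl ← pointsOf-injective (≤-trans (n≤1+n 2) 3≤m) w∈ w′∈ points≡ = refl

  Z : List (List (Fin nP))
  Z = map pointsOf CyclesK ++ map build Tagged

  Z⁺ : Unique Z
  Z⁺ = Unique.++⁺ (map⁺-injectiveOn (pointsOf-injective 2≤k) (PointCycleSeqs⁺ (k + k)))
                  (map⁺-injectiveOn build-injective Tagged⁺) disjoint
    where
    2≤k = ≤-trans (n≤1+n 2) (≤-trans 3≤m (n≤1+n m))
    Tagged⁺ : Unique Tagged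
    Tagged⁺ = dProductWith⁺ _,_ ,-injective (Unique.upTo⁺ k) λ _ →
      dProductWith⁺ _,_ ,-injective (PointCycleSeqs⁺ (m + m)) (extensions⁺ ∘ pointsOf)
    disjoint : ∀ {z} → z ∈ map pointsOf CyclesK × z ∈ map build Tagged → ⊥
    disjoint (z∈ , z∈′) with v , v∈ , refl ← ∈-map⁻ pointsOf z∈
                        with t , t∈ , eq ← ∈-map⁻ build z∈′
                        with j , w , x , refl , j<k , w∈ , x∈ ← ∈-Tagged⁻ t∈ =
      rotate-≢-of-¬H HeadCollinear (pointsOf-Polygon k v∈ (≤-trans 3≤m (n≤1+n m)))
        (proj₁ (seed-OnlyUnrotated w∈ x∈))
        (≤-trans (<⇒≤ j<k) (≤-reflexive (sym (length-seed w∈ x∈)))) (sym eq)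

  Z-arrangement : ∀ {z} → z ∈ Z → Unique z × z ⊆ allFin nP × length z ≡ k
  Z-arrangement z∈ with ∈-++⁻ (map pointsOf CyclesK) z∈
  ... | inj₁ z∈₁ with v , v∈ , refl ← ∈-map⁻ pointsOf z∈₁ =
    pointsOf⁺ k v∈ , (λ {x} _ → ∈-allFin x) , length-pointsOf k v∈
  ... | inj₂ z∈₂ with t , t∈ , refl ← ∈-map⁻ build z∈₂
                 with j , w , x , refl , _ , w∈ , x∈ ← ∈-Tagged⁻ t∈ =
    rotate⁺ j (seed⁺ w∈ x∈) , (λ {x} _ → ∈-allFin x) ,
    trans (length-rotate j (insertSecond x (pointsOf w))) (length-seed w∈ x∈)

  counting : length CyclesK + k * (length CyclesM * c) ≤ N n ₍ k ₎
  counting = begin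
    length CyclesK + k * (length CyclesM * c)
      ≤⟨ +-monoʳ-≤ (length CyclesK) (≤-trans (*-monoʳ-≤ k Seeds-≥) Tagged-≥) ⟩
    length CyclesK + length Tagged
      ≡⟨ cong₂ _+_ (length-map pointsOf CyclesK) (length-map build Tagged) ⟨
    length (map pointsOf CyclesK) + length (map build Tagged)
      ≡⟨ length-++ (map pointsOf CyclesK) ⟨
    length Z
      ≤⟨ length-≤-₍₎ _≟ᶠ_ Z⁺ Z-arrangement ⟩
    length (allFin nP) ₍ k ₎
      ≤⟨ ₍₎-monoˡ-≤ k (≤-trans (≤-reflexive (length-tabulate id)) nP≤N) ⟩
    N n ₍ k ₎
      ∎
    where
    open ≤-Reasoning
    Seeds-≥ : length CyclesM * c ≤ length Seeds
    Seeds-≥ = length-dProductWith-≥ _,_ CyclesM {extensions ∘ pointsOf} c λ {w} w∈ →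
      subst (_≤ length (extensions (pointsOf w)))
            (trans (cong (suc n ∸_) (length-pointsOf m w∈)) (sym c≡suc[n]∸m))
        (length-extensions (pointsOf⁺ m w∈)
          (≤-trans (n≤1+n 2) (≤-trans 3≤m (≤-reflexive (sym (length-pointsOf m w∈))))))
    Tagged-≥ : k * length Seeds ≤ length Tagged
    Tagged-≥ = subst (λ l → l * length Seeds ≤ length Tagged) (length-upTo k)
                 (length-dProductWith-≥ _,_ (upTo k) {λ _ → Seeds} (length Seeds) λ _ → ≤-refl)

2*n≡n+n : ∀ n → 2 * n ≡ n + n
2*n≡n+n n = cong (n +_) (+-identityʳ n)

2*[1+m]∸2≡m+m : ∀ m → 2 * suc m ∸ 2 ≡ m + m
2*[1+m]∸2≡m+m m = trans (cong (_∸ 1) (+-suc m (m + 0))) (cong (m +_) (+-identityʳ m))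

2*k*[c*m*C]≡k*[[m+m]*C*c] : ∀ k c m C → 2 * k * (c * m * C) ≡ k * ((m + m) * C * c)
2*k*[c*m*C]≡k*[[m+m]*C*c] = solve-∀

theorem4 : ∀ (n : ℕ) (Π : ProjectivePlane n) (k : ℕ) → 4 ≤ k → k ≤ n →
    2 * k * cycles (Levi Π) (2 * k)
      + 2 * k * ((n ∸ k + 2) * (k ∸ 1) * cycles (Levi Π) (2 * k ∸ 2))
      ≤ N n ₍ k ₎
theorem4 n Π (suc m) (s≤s 3≤m) m<n = begin
  2 * k * cycles (Levi Π) (2 * k) + 2 * k * (c * m * cycles (Levi Π) (2 * k ∸ 2))
    ≡⟨ cong₂ (λ M M′ → 2 * k * cycles (Levi Π) M + 2 * k * (c * m * cycles (Levi Π) M′))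
             (2*n≡n+n k) (2*[1+m]∸2≡m+m m) ⟩
  2 * k * C₁ + 2 * k * (c * m * C₂)
    ≡⟨ cong₂ _+_ (cong (_* C₁) (2*n≡n+n k)) (2*k*[c*m*C]≡k*[[m+m]*C*c] k c m C₂) ⟩
  (k + k) * C₁ + k * ((m + m) * C₂ * c)
    ≤⟨ +-mono-≤ (*-cycles-≤ (k + k) (≤-trans 3≤m (≤-trans (n≤1+n m) (m≤m+n k k))))
                (*-monoʳ-≤ k (*-monoˡ-≤ c (*-cycles-≤ (m + m) (≤-trans 3≤m (m≤m+n m m))))) ⟩
  length CyclesK + k * (length CyclesM * c)
    ≤⟨ counting ⟩
  N n ₍ k ₎
    ∎
  where
  open ≤-Reasoning
  open LeviCycles Π using (*-cycles-≤)
  open Counting Π 3≤m m<n using (k; c; CyclesK; CyclesM; counting)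
  C₁ = cycles (Levi Π) (k + k)
  C₂ = cycles (Levi Π) (m + m)
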